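{- Let $n\ge 2$, $k\ge1$, and let $m$ be an integer with $k\le m\le\lfloor n/2\rfloor$. Then $m(K^k_{n-m,m},t)\le m(K^k_{n-1,1},t)$ for all $t=0,1,\dots,\lfloor n/2\rfloor$.
   Context: $m(G,t)$ is the number of $t$-matchings (sets of $t$ pairwise disjoint edges) of $G$, $m(G,0)=1$. For $k\le m\le\lfloor n/2\rfloor$, $K^k_{n-m,m}$ is the graph obtained from the disjoint union $K_{n-m}\cup K_m$ by adding $k$ pairwise vertex-disjoint edges each joining a vertex of $K_{n-m}$ to a vertex of $K_m$. $K^k_{n-1,1}$ is the graph obtained from $K_1\cup K_{n-1}$ by adding $k$ edges between the vertex of $K_1$ and $k$ distinct vertices of $K_{n-1}$. -}

module Defs where

open import Data.Nat using (ℕ; zero; suc; _+_; _∸_; _<ᵇ_; _≡ᵇ_)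
open import Data.Bool using (Bool; true; false; _∧_; _∨_; not; if_then_else_)
open import Data.List using (List; []; _∷_; length; filter; concatMap; map; upTo; _++_)
open import Data.Product using (_×_; _,_)
open import Relation.Nullary.Decidable using (Dec)
open import Data.Bool.Properties using (T?)

-- A (simple) graph on the vertex set {0, …, n-1}, given by a Boolean
-- adjacency function on ℕ (only its values on vertices < n matter).
Graph : Set
Graph = ℕ → ℕ → Bool

Edge : Set
Edge = ℕ × ℕ

edges : ℕ → Graph → List Edge
edges n G = concatMap (λ j → map (λ i → (i , j)) (filter (λ i → T? (G i j)) (upTo j))) (upTo n)

-- all sublists (= all subsets, as the edge list has no repetitions)
sublists : {A : Set} → List A → List (List A)
sublists [] = [] ∷ []
sublists (x ∷ xs) = sublists xs ++ map (x ∷_) (sublists xs)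

disjointᵇ : Edge → Edge → Bool
disjointᵇ (a , b) (c , d) = not ((a ≡ᵇ c) ∨ (a ≡ᵇ d) ∨ (b ≡ᵇ c) ∨ (b ≡ᵇ d))

pairwiseDisjointᵇ : List Edge → Bool
pairwiseDisjointᵇ [] = true
pairwiseDisjointᵇ (e ∷ es) = allᵇ es ∧ pairwiseDisjointᵇ es
  where
  allᵇ : List Edge → Bool
  allᵇ [] = true
  allᵇ (f ∷ fs) = disjointᵇ e f ∧ allᵇ fs

isMatchingOfSizeᵇ : ℕ → List Edge → Bool
isMatchingOfSizeᵇ t s = (length s ≡ᵇ t) ∧ pairwiseDisjointᵇ s

matchings : ℕ → Graph → ℕ → ℕ
matchings n G t = length (filter (λ s → T? (isMatchingOfSizeᵇ t s)) (sublists (edges n G)))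

-- K^k_{n-m,m}: vertices 0..n-m-1 form K_{n-m}, vertices n-m..n-1 form K_m,
-- plus the k disjoint edges {i , n-m+i} for i < k.
Kbridge : ℕ → ℕ → ℕ → Graph
Kbridge n m k i j =
  if (i <ᵇ (n ∸ m)) ∧ (j <ᵇ (n ∸ m)) then not (i ≡ᵇ j)
  else if not (i <ᵇ (n ∸ m)) ∧ not (j <ᵇ (n ∸ m)) then not (i ≡ᵇ j)
  else if i <ᵇ (n ∸ m) then (i <ᵇ k) ∧ (j ≡ᵇ ((n ∸ m) + i))
  else (j <ᵇ k) ∧ (i ≡ᵇ ((n ∸ m) + j))

-- K^k_{n-1,1}: vertices 0..n-2 form K_{n-1}, vertex n-1 is K_1,
-- joined to the k vertices 0..k-1.
Kpendant : ℕ → ℕ → Graph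
Kpendant n k i j =
  if (i <ᵇ (n ∸ 1)) ∧ (j <ᵇ (n ∸ 1)) then not (i ≡ᵇ j)
  else if not (i <ᵇ (n ∸ 1)) ∧ not (j <ᵇ (n ∸ 1)) then false
  else if i <ᵇ (n ∸ 1) then i <ᵇ k
  else j <ᵇ k

module Submission where

-- Disjoint unions of at most two cliques are counted by explicit
-- numbers mK, mKK (match-cliques), which satisfy an arithmetic inequality comparing
-- K_p ∪ K_m plus one edge with a complete graph plus a pendant vertex (oneBridge≤pendant).
-- For K^k_{n-m,m} we contract the bridges one at a time: the first contributes exactly
-- m(K_p ∪ K_m, t+1) + m(K_{p-1} ∪ K_{m-1}, t), each further one at most m(K_{n-2}, t)
-- (module Bridges).  For K^k_{n-1,1} the recursion at the pendant vertex gives exactly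
-- m(K_{n-1}, t+1) + k · m(K_{n-2}, t) (match-pendant), and the theorem follows.

open import Defs
open import Data.Nat using (ℕ; zero; suc; _+_; _*_; _∸_; _⊓_; _/_; _≤_; _<_; _≡ᵇ_; _<ᵇ_; z≤n; s≤s; _≟_; _<?_)
open import Data.Nat.Properties
open import Data.Nat.DivMod using (m/n*n≤m)
open import Data.Nat.Solver using (module +-*-Solver)
open +-*-Solver using (solve; _:+_; _:*_; _:=_; con)
open import Data.Bool using (Bool; true; false; _∧_; _∨_; not; if_then_else_; T)
open import Data.Bool.Properties using (T?; ∧-comm; ∧-zeroʳ; ∧-identityʳ; ∧-commutativeMonoid; ∨-commutativeMonoid; ∨-zeroʳ; T-∧; T-≡; ∧-assoc; ∧-inverseʳ)
open import Algebra.Bundles using (CommutativeMonoid)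
open import Algebra.Properties.CommutativeSemigroup (CommutativeMonoid.commutativeSemigroup ∧-commutativeMonoid) using () renaming (x∙yz≈y∙xz to ∧-swap; xy∙z≈xz∙y to ∧-rightComm)
open import Algebra.Properties.CommutativeSemigroup (CommutativeMonoid.commutativeSemigroup ∨-commutativeMonoid) using () renaming (x∙yz≈y∙xz to ∨-swap)
open import Algebra.Properties.CommutativeSemigroup +-commutativeSemigroup using (interchange) renaming (xy∙z≈xz∙y to +-rightComm)
open import Data.List using (List; []; _∷_; _++_; [_]; map; length; filterᵇ; concatMap; upTo)
open import Data.List.Properties using (filter-++; filter-≐; length-++; length-map; concatMap-++; upTo-∷ʳ; map-++; ++-identityʳ; ++-assoc)
open import Data.Product using (_,_)
open import Function using (_∘_; case_of_)
open import Function.Bundles using (Equivalence)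
open import Relation.Nullary using (yes; no)
open import Data.Empty using (⊥-elim)
open import Data.Sum using (_⊎_; inj₁; inj₂; [_,_]′)
open import Relation.Binary.PropositionalEquality hiding ([_])

≡ᵇ-refl : ∀ a → (a ≡ᵇ a) ≡ true
≡ᵇ-refl zero    = refl
≡ᵇ-refl (suc a) = ≡ᵇ-refl a

≡ᵇ-false : ∀ {a b} → a ≢ b → (a ≡ᵇ b) ≡ false
≡ᵇ-false {a} {b} a≢b with a ≡ᵇ b in eq
... | true  = ⊥-elim (a≢b (≡ᵇ⇒≡ a b (subst T (sym eq) _)))
... | false = refl

<ᵇ-true : ∀ {a b} → a < b → (a <ᵇ b) ≡ true
<ᵇ-true a<b = Equivalence.to T-≡ (<⇒<ᵇ a<b)

<ᵇ-false : ∀ {a b} → b ≤ a → (a <ᵇ b) ≡ false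
<ᵇ-false {a} {b} b≤a with a <ᵇ b in eq
... | true  = ⊥-elim (≤⇒≯ b≤a (<ᵇ⇒< a b (subst T (sym eq) _)))
... | false = refl

<ᵇ-suc : ∀ {a j} → a ≢ j → (a <ᵇ suc j) ≡ (a <ᵇ j)
<ᵇ-suc {a} {j} a≢j with a <? j
... | yes a<j = trans (<ᵇ-true (m<n⇒m<1+n a<j)) (sym (<ᵇ-true a<j))
... | no a≮j  = trans (<ᵇ-false (≤∧≢⇒< (≮⇒≥ a≮j) (a≢j ∘ sym))) (sym (<ᵇ-false (≮⇒≥ a≮j)))

≡ᵇ-sym : ∀ a b → (a ≡ᵇ b) ≡ (b ≡ᵇ a)
≡ᵇ-sym zero    zero    = refl
≡ᵇ-sym zero    (suc b) = refl
≡ᵇ-sym (suc a) zero    = refl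
≡ᵇ-sym (suc a) (suc b) = ≡ᵇ-sym a b

disjointᵇ-sym : ∀ e f → disjointᵇ e f ≡ disjointᵇ f e
disjointᵇ-sym (a , b) (c , d)
  rewrite ≡ᵇ-sym c a | ≡ᵇ-sym c b | ≡ᵇ-sym d a | ≡ᵇ-sym d b
  = cong (λ z → not ((a ≡ᵇ c) ∨ z)) (∨-swap (a ≡ᵇ d) (b ≡ᵇ c) (b ≡ᵇ d))

disjointᵇ-shared : ∀ x y a b → x ≡ a ⊎ x ≡ b ⊎ y ≡ a ⊎ y ≡ b → disjointᵇ (x , y) (a , b) ≡ false
disjointᵇ-shared x y a b (inj₁ refl) rewrite ≡ᵇ-refl x = refl
disjointᵇ-shared x y a b (inj₂ (inj₁ refl)) rewrite ≡ᵇ-refl x | ∨-zeroʳ (x ≡ᵇ a) = refl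
disjointᵇ-shared x y a b (inj₂ (inj₂ (inj₁ refl))) rewrite ≡ᵇ-refl y | ∨-zeroʳ (x ≡ᵇ b) | ∨-zeroʳ (x ≡ᵇ y) = refl
disjointᵇ-shared x y a b (inj₂ (inj₂ (inj₂ refl))) rewrite ≡ᵇ-refl y | ∨-zeroʳ (y ≡ᵇ a) | ∨-zeroʳ (x ≡ᵇ y) | ∨-zeroʳ (x ≡ᵇ a) = refl

disjointᵇ-apart : ∀ {x y a b} → x ≢ a → x ≢ b → y ≢ a → y ≢ b → disjointᵇ (x , y) (a , b) ≡ true
disjointᵇ-apart x≢a x≢b y≢a y≢b rewrite ≡ᵇ-false x≢a | ≡ᵇ-false x≢b | ≡ᵇ-false y≢a | ≡ᵇ-false y≢b = refl

∧-replace : ∀ d x x' y p → x ∧ p ≡ x' ∧ p → (d ∧ x) ∧ (y ∧ p) ≡ (d ∧ x') ∧ (y ∧ p)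
∧-replace d x x' y false _ rewrite ∧-zeroʳ y | ∧-zeroʳ (d ∧ x) | ∧-zeroʳ (d ∧ x') = refl
∧-replace d x x' y true  h = cong (λ z → (d ∧ z) ∧ (y ∧ true)) (trans (sym (∧-identityʳ x)) (trans h (∧-identityʳ x')))

∧-not-self : ∀ x z → x ∧ (not x ∧ z) ≡ false
∧-not-self x z = trans (sym (∧-assoc x (not x) z)) (cong (_∧ z) (∧-inverseʳ x))

filterᵇ-cong : {A : Set} {p q : A → Bool} → (∀ a → p a ≡ q a) → ∀ xs → filterᵇ p xs ≡ filterᵇ q xs
filterᵇ-cong p≗q = filter-≐ _ _ ((λ {a} → subst T (p≗q a)) , (λ {a} → subst T (sym (p≗q a))))

filterᵇ-∧ : {A : Set} (p q : A → Bool) (xs : List A) → filterᵇ q (filterᵇ p xs) ≡ filterᵇ (λ a → p a ∧ q a) xs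
filterᵇ-∧ p q [] = refl
filterᵇ-∧ p q (x ∷ xs) with p x
... | false = filterᵇ-∧ p q xs
... | true with q x
...   | true  = cong (x ∷_) (filterᵇ-∧ p q xs)
...   | false = filterᵇ-∧ p q xs

filterᵇ-comm : {A : Set} (p q : A → Bool) (xs : List A) → filterᵇ p (filterᵇ q xs) ≡ filterᵇ q (filterᵇ p xs)
filterᵇ-comm p q xs = begin
  filterᵇ p (filterᵇ q xs)        ≡⟨ filterᵇ-∧ q p xs ⟩
  filterᵇ (λ a → q a ∧ p a) xs    ≡⟨ filterᵇ-cong (λ a → ∧-comm (q a) (p a)) xs ⟩
  filterᵇ (λ a → p a ∧ q a) xs    ≡⟨ filterᵇ-∧ p q xs ⟨
  filterᵇ q (filterᵇ p xs)        ∎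
  where open ≡-Reasoning

filterᵇ-map : {A B : Set} (p : B → Bool) (f : A → B) (xs : List A) → filterᵇ p (map f xs) ≡ map f (filterᵇ (p ∘ f) xs)
filterᵇ-map p f [] = refl
filterᵇ-map p f (x ∷ xs) with p (f x)
... | true  = cong (f x ∷_) (filterᵇ-map p f xs)
... | false = filterᵇ-map p f xs

filterᵇ-none : {A : Set} (p : A → Bool) → (∀ a → p a ≡ false) → ∀ xs → filterᵇ p xs ≡ []
filterᵇ-none p none [] = refl
filterᵇ-none p none (x ∷ xs) rewrite none x = filterᵇ-none p none xs

length-filterᵇ-++ : {A : Set} (p : A → Bool) (xs ys : List A) → length (filterᵇ p (xs ++ ys)) ≡ length (filterᵇ p xs) + length (filterᵇ p ys)
length-filterᵇ-++ p xs ys = trans (cong length (filter-++ (T? ∘ p) xs ys)) (length-++ (filterᵇ p xs))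

sumTo : ℕ → (ℕ → ℕ) → ℕ
sumTo zero    f = 0
sumTo (suc n) f = sumTo n f + f n

sumTo-ones : ∀ n → sumTo n (λ _ → 1) ≡ n
sumTo-ones zero    = refl
sumTo-ones (suc n) = trans (cong (_+ 1) (sumTo-ones n)) (+-comm n 1)

sumTo-cong : ∀ n {f g : ℕ → ℕ} → (∀ i → i < n → f i ≡ g i) → sumTo n f ≡ sumTo n g
sumTo-cong zero    f≗g = refl
sumTo-cong (suc n) f≗g = cong₂ _+_ (sumTo-cong n (λ i i<n → f≗g i (m<n⇒m<1+n i<n))) (f≗g n ≤-refl)

sumTo-mono : ∀ n {f g : ℕ → ℕ} → (∀ i → i < n → f i ≤ g i) → sumTo n f ≤ sumTo n g
sumTo-mono zero    f≤g = z≤n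
sumTo-mono (suc n) f≤g = +-mono-≤ (sumTo-mono n (λ i i<n → f≤g i (m<n⇒m<1+n i<n))) (f≤g n ≤-refl)

sumTo-zero : ∀ n {f : ℕ → ℕ} → (∀ i → i < n → f i ≡ 0) → sumTo n f ≡ 0
sumTo-zero zero    f≗0 = refl
sumTo-zero (suc n) f≗0 = cong₂ _+_ (sumTo-zero n (λ i i<n → f≗0 i (m<n⇒m<1+n i<n))) (f≗0 n ≤-refl)

sumTo-+ : ∀ n (f g : ℕ → ℕ) → sumTo n (λ i → f i + g i) ≡ sumTo n f + sumTo n g
sumTo-+ zero    f g = refl
sumTo-+ (suc n) f g = trans (cong (_+ (f n + g n)) (sumTo-+ n f g)) (interchange (sumTo n f) (sumTo n g) (f n) (g n))

sumTo-split : ∀ n {f g : ℕ → ℕ} x → x < n → (∀ i → i < n → i ≢ x → f i ≡ g i) → g x ≡ 0 →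
  sumTo n f ≡ sumTo n g + f x
sumTo-split (suc n) {f} {g} x x<1+n f≗g gx≡0 with x ≟ n
... | yes refl = cong (_+ f x) (begin
  sumTo x f          ≡⟨ sumTo-cong x (λ i i<x → f≗g i (m<n⇒m<1+n i<x) (<⇒≢ i<x)) ⟩
  sumTo x g          ≡⟨ +-identityʳ (sumTo x g) ⟨
  sumTo x g + 0      ≡⟨ cong (sumTo x g +_) gx≡0 ⟨
  sumTo x g + g x    ∎)
  where open ≡-Reasoning
... | no x≢n = begin
  sumTo n f + f n            ≡⟨ cong₂ _+_ (sumTo-split n x x<n (λ i i<n → f≗g i (m<n⇒m<1+n i<n)) gx≡0) (f≗g n ≤-refl (x≢n ∘ sym)) ⟩
  (sumTo n g + f x) + g n    ≡⟨ +-rightComm (sumTo n g) (f x) (g n) ⟩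
  (sumTo n g + g n) + f x    ∎
  where
  open ≡-Reasoning
  x<n : x < n
  x<n = ≤∧≢⇒< (≤-pred x<1+n) x≢n

sumTo-indicator : ∀ n (p : ℕ → Bool) K → sumTo n (λ i → if p i then K else 0) ≡ sumTo n (λ i → if p i then 1 else 0) * K
sumTo-indicator zero    p K = refl
sumTo-indicator (suc n) p K with p n
... | true  = trans (cong (_+ K) (sumTo-indicator n p K)) (sym (trans (*-distribʳ-+ K count 1) (cong (count * K +_) (*-identityˡ K))))
  where
  count : ℕ
  count = sumTo n (λ i → if p i then 1 else 0)
... | false = trans (+-identityʳ _) (trans (sumTo-indicator n p K) (cong (_* K) (sym (+-identityʳ count))))
  where
  count : ℕ
  count = sumTo n (λ i → if p i then 1 else 0)

count-below : ∀ n p → sumTo n (λ i → if i <ᵇ p then 1 else 0) ≡ n ⊓ p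
count-below zero    p = refl
count-below (suc n) p with n <? p
... | yes n<p rewrite <ᵇ-true n<p =
  trans (cong (_+ 1) (trans (count-below n p) (m≤n⇒m⊓n≡m (<⇒≤ n<p)))) (trans (+-comm n 1) (sym (m≤n⇒m⊓n≡m n<p)))
... | no n≮p rewrite <ᵇ-false (≮⇒≥ n≮p) =
  trans (+-identityʳ _) (trans (count-below n p) (trans (m≥n⇒m⊓n≡n (≮⇒≥ n≮p)) (sym (m≥n⇒m⊓n≡n (m≤n⇒m≤1+n (≮⇒≥ n≮p))))))

count-below-≤ : ∀ n p → p ≤ n → sumTo n (λ i → if i <ᵇ p then 1 else 0) ≡ p
count-below-≤ n p p≤n = trans (count-below n p) (m≥n⇒m⊓n≡n p≤n)

count-above-≤ : ∀ n p → p ≤ n → sumTo n (λ i → if i <ᵇ p then 0 else 1) ≡ n ∸ p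
count-above-≤ n p p≤n = begin
  above                        ≡⟨ m+n∸m≡n p above ⟨
  p + above ∸ p                ≡⟨ cong (λ q → q + above ∸ p) (count-below-≤ n p p≤n) ⟨
  below + above ∸ p            ≡⟨ cong (_∸ p) (sumTo-+ n _ _) ⟨
  sumTo n (λ i → (if i <ᵇ p then 1 else 0) + (if i <ᵇ p then 0 else 1)) ∸ p
                               ≡⟨ cong (_∸ p) (trans (sumTo-cong n either) (sumTo-ones n)) ⟩
  n ∸ p                        ∎
  where
  open ≡-Reasoning
  below above : ℕ
  below = sumTo n (λ i → if i <ᵇ p then 1 else 0)
  above = sumTo n (λ i → if i <ᵇ p then 0 else 1)
  either : ∀ i → i < n → (if i <ᵇ p then 1 else 0) + (if i <ᵇ p then 0 else 1) ≡ 1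
  either i _ with i <ᵇ p
  ... | true  = refl
  ... | false = refl

avoiding : Edge → List Edge → List Edge
avoiding e = filterᵇ (disjointᵇ e)

avoidsAll : Edge → List Edge → Bool
avoidsAll e [] = true
avoidsAll e (f ∷ fs) = disjointᵇ e f ∧ avoidsAll e fs

pairwiseDisjoint-∷ : ∀ e es → pairwiseDisjointᵇ (e ∷ es) ≡ avoidsAll e es ∧ pairwiseDisjointᵇ es
pairwiseDisjoint-∷ e [] = refl
pairwiseDisjoint-∷ e (f ∷ fs) = ∧-replace (disjointᵇ e f) _ (avoidsAll e fs) _ (pairwiseDisjointᵇ fs) (pairwiseDisjoint-∷ e fs)

isMatching-∷ : ∀ t e s → isMatchingOfSizeᵇ (suc t) (e ∷ s) ≡ avoidsAll e s ∧ isMatchingOfSizeᵇ t s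
isMatching-∷ t e s = trans (cong ((length s ≡ᵇ t) ∧_) (pairwiseDisjoint-∷ e s)) (∧-swap (length s ≡ᵇ t) (avoidsAll e s) (pairwiseDisjointᵇ s))

sublists-avoiding : ∀ e E → filterᵇ (avoidsAll e) (sublists E) ≡ sublists (avoiding e E)
sublists-avoiding e [] = refl
sublists-avoiding e (f ∷ E)
  rewrite filter-++ (T? ∘ avoidsAll e) (sublists E) (map (f ∷_) (sublists E))
        | filterᵇ-map (avoidsAll e) (f ∷_) (sublists E)
        | sublists-avoiding e E
  with disjointᵇ e f
... | true  = cong (λ S → sublists (avoiding e E) ++ map (f ∷_) S) (sublists-avoiding e E)
... | false = trans (cong (λ S → sublists (avoiding e E) ++ map (f ∷_) S) (filterᵇ-none _ (λ _ → refl) (sublists E))) (++-identityʳ _)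

-- The deletion recursion for matchings of an edge list: a (t+1)-matching either
-- avoids the first edge e, or uses it together with a t-matching avoiding e.
matchCount : List Edge → ℕ → ℕ
matchCount E       zero    = 1
matchCount []      (suc t) = 0
matchCount (e ∷ E) (suc t) = matchCount E (suc t) + matchCount (avoiding e E) t

matchCount-correct : ∀ E t → length (filterᵇ (isMatchingOfSizeᵇ t) (sublists E)) ≡ matchCount E t
matchCount-correct [] zero = refl
matchCount-correct [] (suc t) = refl
matchCount-correct (e ∷ E) zero = begin
  length (filterᵇ M₀ (sublists E ++ map (e ∷_) (sublists E)))
    ≡⟨ length-filterᵇ-++ M₀ (sublists E) _ ⟩
  length (filterᵇ M₀ (sublists E)) + length (filterᵇ M₀ (map (e ∷_) (sublists E)))
    ≡⟨ cong₂ _+_ (matchCount-correct E zero) (cong length (trans (filterᵇ-map M₀ (e ∷_) (sublists E)) (cong (map (e ∷_)) (filterᵇ-none _ (λ _ → refl) (sublists E))))) ⟩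
  1 ∎
  where
  open ≡-Reasoning
  M₀ : List Edge → Bool
  M₀ = isMatchingOfSizeᵇ zero
matchCount-correct (e ∷ E) (suc t) = begin
  length (filterᵇ M (sublists E ++ map (e ∷_) (sublists E)))
    ≡⟨ length-filterᵇ-++ M (sublists E) _ ⟩
  length (filterᵇ M (sublists E)) + length (filterᵇ M (map (e ∷_) (sublists E)))
    ≡⟨ cong₂ _+_ (matchCount-correct E (suc t)) (cong length (filterᵇ-map M (e ∷_) (sublists E))) ⟩
  matchCount E (suc t) + length (map (e ∷_) (filterᵇ (M ∘ (e ∷_)) (sublists E)))
    ≡⟨ cong (matchCount E (suc t) +_) (length-map (e ∷_) (filterᵇ (M ∘ (e ∷_)) (sublists E))) ⟩
  matchCount E (suc t) + length (filterᵇ (M ∘ (e ∷_)) (sublists E))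
    ≡⟨ cong (λ S → matchCount E (suc t) + length S) (filterᵇ-cong (isMatching-∷ t e) (sublists E)) ⟩
  matchCount E (suc t) + length (filterᵇ (λ s → avoidsAll e s ∧ isMatchingOfSizeᵇ t s) (sublists E))
    ≡⟨ cong (λ S → matchCount E (suc t) + length S) (filterᵇ-∧ (avoidsAll e) (isMatchingOfSizeᵇ t) (sublists E)) ⟨
  matchCount E (suc t) + length (filterᵇ (isMatchingOfSizeᵇ t) (filterᵇ (avoidsAll e) (sublists E)))
    ≡⟨ cong (λ S → matchCount E (suc t) + length (filterᵇ (isMatchingOfSizeᵇ t) S)) (sublists-avoiding e E) ⟩
  matchCount E (suc t) + length (filterᵇ (isMatchingOfSizeᵇ t) (sublists (avoiding e E)))
    ≡⟨ cong (matchCount E (suc t) +_) (matchCount-correct (avoiding e E) t) ⟩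
  matchCount (e ∷ E) (suc t) ∎
  where
  open ≡-Reasoning
  M : List Edge → Bool
  M = isMatchingOfSizeᵇ (suc t)

matchCount-snoc : ∀ E s t → matchCount (E ++ [ s ]) (suc t) ≡ matchCount E (suc t) + matchCount (avoiding s E) t
matchCount-snoc [] s t = refl
matchCount-snoc (e ∷ E) s t
  rewrite filter-++ (T? ∘ disjointᵇ e) E [ s ]
  with disjointᵇ e s in e∼s
... | false rewrite trans (disjointᵇ-sym s e) e∼s = begin
  matchCount (E ++ [ s ]) (suc t) + matchCount (avoiding e E ++ []) t
    ≡⟨ cong₂ _+_ (matchCount-snoc E s t) (cong (λ F → matchCount F t) (++-identityʳ (avoiding e E))) ⟩
  (matchCount E (suc t) + matchCount (avoiding s E) t) + matchCount (avoiding e E) t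
    ≡⟨ +-rightComm (matchCount E (suc t)) (matchCount (avoiding s E) t) (matchCount (avoiding e E) t) ⟩
  matchCount (e ∷ E) (suc t) + matchCount (avoiding s E) t ∎
  where open ≡-Reasoning
... | true rewrite trans (disjointᵇ-sym s e) e∼s with t
...   | zero = cong (_+ 1) (matchCount-snoc E s zero)
...   | suc t' = begin
  matchCount (E ++ [ s ]) (suc (suc t')) + matchCount (avoiding e E ++ [ s ]) (suc t')
    ≡⟨ cong₂ _+_ (matchCount-snoc E s (suc t')) (matchCount-snoc (avoiding e E) s t') ⟩
  (matchCount E (suc (suc t')) + matchCount (avoiding s E) (suc t')) + (matchCount (avoiding e E) (suc t') + matchCount (avoiding s (avoiding e E)) t')
    ≡⟨ cong (λ F → (matchCount E (suc (suc t')) + matchCount (avoiding s E) (suc t')) + (matchCount (avoiding e E) (suc t') + matchCount F t')) (filterᵇ-comm (disjointᵇ s) (disjointᵇ e) E) ⟩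
  (matchCount E (suc (suc t')) + matchCount (avoiding s E) (suc t')) + (matchCount (avoiding e E) (suc t') + matchCount (avoiding e (avoiding s E)) t')
    ≡⟨ interchange (matchCount E (suc (suc t'))) _ _ _ ⟩
  matchCount (e ∷ E) (suc (suc t')) + matchCount (e ∷ avoiding s E) (suc t') ∎
  where open ≡-Reasoning

-- G ∖ e: the graph G with both endpoints of e deleted.
_∖_ : Graph → Edge → Graph
(G ∖ e) a b = G a b ∧ disjointᵇ e (a , b)

star : ℕ → List ℕ → List Edge
star n = map (λ i → (i , n))

star-avoiding : ∀ j n L → avoiding (j , n) (star n L) ≡ []
star-avoiding j n L = trans (filterᵇ-map (disjointᵇ (j , n)) (λ i → (i , n)) L) (cong (map (λ i → (i , n))) (filterᵇ-none _ meets L))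
  where
  meets : ∀ i → disjointᵇ (j , n) (i , n) ≡ false
  meets i rewrite ≡ᵇ-refl n | ∨-zeroʳ (n ≡ᵇ i) | ∨-zeroʳ (j ≡ᵇ n) | ∨-zeroʳ (j ≡ᵇ i) = refl

-- Appending one more star edge (j , n), when p j holds: by matchCount-snoc, since the
-- edges avoiding (j , n) are those of E avoiding it (star edges all meet n).
matchCount-star-snoc : ∀ (p : ℕ → Bool) n E t L j →
  matchCount (E ++ star n (filterᵇ p (L ++ [ j ]))) (suc t)
    ≡ matchCount (E ++ star n (filterᵇ p L)) (suc t) + (if p j then matchCount (avoiding (j , n) E) t else 0)
matchCount-star-snoc p n E t L j
  rewrite filter-++ (T? ∘ p) L [ j ] | map-++ (λ i → (i , n)) (filterᵇ p L) (filterᵇ p [ j ])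
  with p j
... | false = trans (cong (λ F → matchCount (E ++ F) (suc t)) (++-identityʳ (star n (filterᵇ p L)))) (sym (+-identityʳ _))
... | true = begin
  matchCount (E ++ S ++ [ (j , n) ]) (suc t)
    ≡⟨ cong (λ F → matchCount F (suc t)) (++-assoc E S [ (j , n) ]) ⟨
  matchCount ((E ++ S) ++ [ (j , n) ]) (suc t)
    ≡⟨ matchCount-snoc (E ++ S) (j , n) t ⟩
  matchCount (E ++ S) (suc t) + matchCount (avoiding (j , n) (E ++ S)) t
    ≡⟨ cong (λ F → matchCount (E ++ S) (suc t) + matchCount F t) avoid ⟩
  matchCount (E ++ S) (suc t) + matchCount (avoiding (j , n) E) t ∎
  where
  open ≡-Reasoning
  S : List Edge
  S = star n (filterᵇ p L)
  avoid : avoiding (j , n) (E ++ S) ≡ avoiding (j , n) E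
  avoid = trans (filter-++ (T? ∘ disjointᵇ (j , n)) E S) (trans (cong (avoiding (j , n) E ++_) (star-avoiding j n (filterᵇ p L))) (++-identityʳ _))

matchCount-star : ∀ (p : ℕ → Bool) n E t j →
  matchCount (E ++ star n (filterᵇ p (upTo j))) (suc t)
    ≡ matchCount E (suc t) + sumTo j (λ i → if p i then matchCount (avoiding (i , n) E) t else 0)
matchCount-star p n E t zero = trans (cong (λ F → matchCount F (suc t)) (++-identityʳ E)) (sym (+-identityʳ _))
matchCount-star p n E t (suc j) = begin
  matchCount (E ++ star n (filterᵇ p (upTo (suc j)))) (suc t)
    ≡⟨ cong (λ L → matchCount (E ++ star n (filterᵇ p L)) (suc t)) (upTo-∷ʳ j) ⟨
  matchCount (E ++ star n (filterᵇ p (upTo j ++ [ j ]))) (suc t)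
    ≡⟨ matchCount-star-snoc p n E t (upTo j) j ⟩
  matchCount (E ++ star n (filterᵇ p (upTo j))) (suc t) + f j
    ≡⟨ cong (_+ f j) (matchCount-star p n E t j) ⟩
  matchCount E (suc t) + sumTo j f + f j
    ≡⟨ +-assoc (matchCount E (suc t)) (sumTo j f) (f j) ⟩
  matchCount E (suc t) + sumTo (suc j) f ∎
  where
  open ≡-Reasoning
  f : ℕ → ℕ
  f i = if p i then matchCount (avoiding (i , n) E) t else 0

neighboursBelow : Graph → ℕ → List ℕ
neighboursBelow G n = filterᵇ (λ i → G i n) (upTo n)

edges-suc : ∀ n G → edges (suc n) G ≡ edges n G ++ star n (neighboursBelow G n)
edges-suc n G = begin
  concatMap row (upTo (suc n))             ≡⟨ cong (concatMap row) (upTo-∷ʳ n) ⟨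
  concatMap row (upTo n ++ [ n ])          ≡⟨ concatMap-++ row (upTo n) [ n ] ⟩
  edges n G ++ (row n ++ [])               ≡⟨ cong (edges n G ++_) (++-identityʳ (row n)) ⟩
  edges n G ++ row n                       ∎
  where
  open ≡-Reasoning
  row : ℕ → List Edge
  row j = star j (neighboursBelow G j)

avoiding-edges : ∀ e n G → avoiding e (edges n G) ≡ edges n (G ∖ e)
avoiding-edges e zero G = refl
avoiding-edges e (suc n) G = begin
  avoiding e (edges (suc n) G)
    ≡⟨ cong (avoiding e) (edges-suc n G) ⟩
  avoiding e (edges n G ++ star n (neighboursBelow G n))
    ≡⟨ filter-++ (T? ∘ disjointᵇ e) (edges n G) _ ⟩
  avoiding e (edges n G) ++ avoiding e (star n (neighboursBelow G n))
    ≡⟨ cong₂ _++_ (avoiding-edges e n G) (filterᵇ-map (disjointᵇ e) (λ i → (i , n)) (neighboursBelow G n)) ⟩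
  edges n (G ∖ e) ++ star n (filterᵇ (λ i → disjointᵇ e (i , n)) (neighboursBelow G n))
    ≡⟨ cong (λ L → edges n (G ∖ e) ++ star n L) (filterᵇ-∧ (λ i → G i n) (λ i → disjointᵇ e (i , n)) (upTo n)) ⟩
  edges n (G ∖ e) ++ star n (neighboursBelow (G ∖ e) n)
    ≡⟨ edges-suc n (G ∖ e) ⟨
  edges (suc n) (G ∖ e) ∎
  where open ≡-Reasoning

-- The vertex recursion for matchings of a graph on {0,…,n}: a (t+1)-matching either leaves
-- the last vertex n unmatched, or matches it to a neighbour i < n, the rest being a
-- t-matching of G with i and n deleted.
match : ℕ → Graph → ℕ → ℕ
match n       G zero    = 1
match zero    G (suc t) = 0
match (suc n) G (suc t) = match n G (suc t) + sumTo n (λ i → if G i n then match n (G ∖ (i , n)) t else 0)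

matchCount-edges : ∀ n G t → matchCount (edges n G) t ≡ match n G t
matchCount-edges n       G zero    = refl
matchCount-edges zero    G (suc t) = refl
matchCount-edges (suc n) G (suc t) = begin
  matchCount (edges (suc n) G) (suc t)
    ≡⟨ cong (λ E → matchCount E (suc t)) (edges-suc n G) ⟩
  matchCount (edges n G ++ star n (neighboursBelow G n)) (suc t)
    ≡⟨ matchCount-star (λ i → G i n) n (edges n G) t n ⟩
  matchCount (edges n G) (suc t) + sumTo n (λ i → if G i n then matchCount (avoiding (i , n) (edges n G)) t else 0)
    ≡⟨ cong₂ _+_ (matchCount-edges n G (suc t)) (sumTo-cong n (λ i _ → cong (if G i n then_else 0) (deleted i))) ⟩
  match (suc n) G (suc t) ∎
  where
  open ≡-Reasoning
  deleted : ∀ i → matchCount (avoiding (i , n) (edges n G)) t ≡ match n (G ∖ (i , n)) t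
  deleted i = trans (cong (λ E → matchCount E t) (avoiding-edges (i , n) n G)) (matchCount-edges n (G ∖ (i , n)) t)

matchings≡match : ∀ n G t → matchings n G t ≡ match n G t
matchings≡match n G t = trans (matchCount-correct (edges n G) t) (matchCount-edges n G t)

_≈[_]_ : Graph → ℕ → Graph → Set
G ≈[ n ] H = ∀ a b → a < b → b < n → G a b ≡ H a b

_⊆[_]_ : Graph → ℕ → Graph → Set
G ⊆[ n ] H = ∀ a b → a < b → b < n → T (G a b) → T (H a b)

≈-pred : ∀ {n G H} → G ≈[ suc n ] H → G ≈[ n ] H
≈-pred G≈H a b a<b b<n = G≈H a b a<b (m<n⇒m<1+n b<n)

≈-sym : ∀ {n G H} → G ≈[ n ] H → H ≈[ n ] G
≈-sym G≈H a b a<b b<n = sym (G≈H a b a<b b<n)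

≈-trans : ∀ {n G H K} → G ≈[ n ] H → H ≈[ n ] K → G ≈[ n ] K
≈-trans G≈H H≈K a b a<b b<n = trans (G≈H a b a<b b<n) (H≈K a b a<b b<n)

∖-cong : ∀ {n G H} e → G ≈[ n ] H → (G ∖ e) ≈[ n ] (H ∖ e)
∖-cong e G≈H a b a<b b<n = cong (_∧ disjointᵇ e (a , b)) (G≈H a b a<b b<n)

match-cong : ∀ n {G H} t → G ≈[ n ] H → match n G t ≡ match n H t
match-cong n       zero    G≈H = refl
match-cong zero    (suc t) G≈H = refl
match-cong (suc n) (suc t) G≈H =
  cong₂ _+_ (match-cong n (suc t) (≈-pred G≈H))
            (sumTo-cong n (λ i i<n → cong₂ (λ b r → if b then r else 0) (G≈H i n i<n ≤-refl) (match-cong n t (∖-cong (i , n) (≈-pred G≈H)))))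

∖-mono : ∀ {n G H} e → G ⊆[ n ] H → (G ∖ e) ⊆[ n ] (H ∖ e)
∖-mono {G = G} {H} e G⊆H a b a<b b<n Gab∧d =
  let (Gab , d) = Equivalence.to (T-∧ {G a b}) Gab∧d
  in Equivalence.from (T-∧ {H a b}) (G⊆H a b a<b b<n Gab , d)

match-mono : ∀ n {G H} t → G ⊆[ n ] H → match n G t ≤ match n H t
match-mono n       zero    G⊆H = ≤-refl
match-mono zero    (suc t) G⊆H = ≤-refl
match-mono (suc n) {G} {H} (suc t) G⊆H =
  +-mono-≤ (match-mono n (suc t) G⊆H↾n)
           (sumTo-mono n (λ i i<n → term (G i n) (H i n) (G⊆H i n i<n ≤-refl) (match-mono n t (∖-mono (i , n) G⊆H↾n))))
  where
  G⊆H↾n : G ⊆[ n ] H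
  G⊆H↾n a b a<b b<n = G⊆H a b a<b (m<n⇒m<1+n b<n)
  term : ∀ x y {A B} → (T x → T y) → A ≤ B → (if x then A else 0) ≤ (if y then B else 0)
  term true  true  _ A≤B = A≤B
  term true  false x⇒y _ = ⊥-elim (x⇒y _)
  term false _     _ _   = z≤n

match-isolated : ∀ n G t → (∀ i → i < n → G i n ≡ false) → match (suc n) G t ≡ match n G t
match-isolated n G zero    isolated = refl
match-isolated n G (suc t) isolated =
  trans (cong (match n G (suc t) +_) (sumTo-zero n (λ i i<n → cong (if_then match n (G ∖ (i , n)) t else 0) (isolated i i<n))))
        (+-identityʳ _)

∖-meets : ∀ G e a b → disjointᵇ e (a , b) ≡ false → (G ∖ e) a b ≡ false
∖-meets G e a b meets rewrite meets = ∧-zeroʳ (G a b)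

∖-apart : ∀ G e a b → disjointᵇ e (a , b) ≡ true → (G ∖ e) a b ≡ G a b
∖-apart G e a b apart rewrite apart = ∧-identityʳ (G a b)

∖-comm : ∀ G e f a b → ((G ∖ e) ∖ f) a b ≡ ((G ∖ f) ∖ e) a b
∖-comm G e f a b = ∧-rightComm (G a b) (disjointᵇ e (a , b)) (disjointᵇ f (a , b))

deleteEdge : ℕ → ℕ → Graph → Graph
deleteEdge x y G a b = G a b ∧ not ((a ≡ᵇ x) ∧ (b ≡ᵇ y))

deleteEdge-removes : ∀ x y G → deleteEdge x y G x y ≡ false
deleteEdge-removes x y G rewrite ≡ᵇ-refl x | ≡ᵇ-refl y = ∧-zeroʳ (G x y)

deleteEdge-keeps : ∀ {x y} G {a b} → a ≢ x ⊎ b ≢ y → deleteEdge x y G a b ≡ G a b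
deleteEdge-keeps G {a} {b} (inj₁ a≢x) rewrite ≡ᵇ-false a≢x = ∧-identityʳ (G a b)
deleteEdge-keeps {x} G {a} {b} (inj₂ b≢y) rewrite ≡ᵇ-false b≢y | ∧-zeroʳ (a ≡ᵇ x) = ∧-identityʳ (G a b)

deleteEdge-beyond : ∀ x y G {n} → n ≤ y → deleteEdge x y G ≈[ n ] G
deleteEdge-beyond x y G n≤y a b a<b b<n = deleteEdge-keeps G (inj₂ λ b≡y → <⇒≱ b<n (subst (_ ≤_) (sym b≡y) n≤y))

deleteEdge-hidden : ∀ x y G e a b → disjointᵇ e (x , y) ≡ false → (deleteEdge x y G ∖ e) a b ≡ (G ∖ e) a b
deleteEdge-hidden x y G e a b meets with a ≟ x | b ≟ y
... | yes refl | yes refl rewrite meets = trans (∧-zeroʳ _) (sym (∧-zeroʳ (G a b)))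
... | no a≢x   | _        = cong (_∧ disjointᵇ e (a , b)) (deleteEdge-keeps G (inj₁ a≢x))
... | yes _    | no b≢y   = cong (_∧ disjointᵇ e (a , b)) (deleteEdge-keeps G (inj₂ b≢y))

deleteEdge-∖ : ∀ x y G e a b → deleteEdge x y (G ∖ e) a b ≡ (deleteEdge x y G ∖ e) a b
deleteEdge-∖ x y G e a b = ∧-rightComm (G a b) (disjointᵇ e (a , b)) (not ((a ≡ᵇ x) ∧ (b ≡ᵇ y)))

-- Deletion–contraction for an edge {x , y} of G: a (t+1)-matching either avoids the edge or
-- uses it, and those using it correspond to t-matchings of G with x and y deleted.
match-deleteEdge-last : ∀ n G x t → x < n → T (G x n) →
  match (suc n) G (suc t) ≡ match (suc n) (deleteEdge x n G) (suc t) + match (suc n) (G ∖ (x , n)) t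
match-deleteEdge-last n G x t x<n xn∈G = begin
  match n G (suc t) + sumTo n f
    ≡⟨ cong₂ _+_ (match-cong n (suc t) (≈-sym G'≈G)) (sumTo-split n x x<n same f'x≡0) ⟩
  match n G' (suc t) + (sumTo n f' + f x)
    ≡⟨ +-assoc (match n G' (suc t)) (sumTo n f') (f x) ⟨
  match (suc n) G' (suc t) + f x
    ≡⟨ cong (match (suc n) G' (suc t) +_) uses ⟩
  match (suc n) G' (suc t) + match (suc n) (G ∖ (x , n)) t ∎
  where
  open ≡-Reasoning
  G' : Graph
  G' = deleteEdge x n G
  G'≈G : G' ≈[ n ] G
  G'≈G = deleteEdge-beyond x n G ≤-refl
  f f' : ℕ → ℕ
  f  i = if G  i n then match n (G  ∖ (i , n)) t else 0
  f' i = if G' i n then match n (G' ∖ (i , n)) t else 0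
  same : ∀ i → i < n → i ≢ x → f i ≡ f' i
  same i _ i≢x = cong₂ (λ b r → if b then r else 0) (sym (deleteEdge-keeps G (inj₁ i≢x))) (match-cong n t (∖-cong (i , n) (≈-sym G'≈G)))
  f'x≡0 : f' x ≡ 0
  f'x≡0 = cong (λ b → if b then match n (G' ∖ (x , n)) t else 0) (deleteEdge-removes x n G)
  -- in G ∖ (x , n) the vertex n is isolated
  uses : f x ≡ match (suc n) (G ∖ (x , n)) t
  uses rewrite Equivalence.to T-≡ xn∈G =
    sym (match-isolated n (G ∖ (x , n)) t (λ i _ → ∖-meets G (x , n) i n (disjointᵇ-shared x n i n (inj₂ (inj₂ (inj₂ refl))))))

-- In the vertex recursion at the last vertex n ≠ y, a neighbour i that is an endpoint of
-- {x , y} contributes the same to G and to G without the edge (deleting i deletes the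
-- edge), and nothing to G ∖ (x , y).
deleteEdge-endpointTerm : ∀ n G x y t i → y ≢ n → i ≡ x ⊎ i ≡ y →
  (if G i n then match n (G ∖ (i , n)) (suc t) else 0)
    ≡ (if deleteEdge x y G i n then match n (deleteEdge x y G ∖ (i , n)) (suc t) else 0)
      + (if (G ∖ (x , y)) i n then match n ((G ∖ (x , y)) ∖ (i , n)) t else 0)
deleteEdge-endpointTerm n G x y t i y≢n i∈xy =
  trans (cong₂ (λ b m → if b then m else 0) (sym (deleteEdge-keeps {x} G (inj₂ (y≢n ∘ sym)))) (sym (match-cong n (suc t) hidden)))
        (sym (trans (cong (kept +_) absent) (+-identityʳ kept)))
  where
  kept : ℕ
  kept = if deleteEdge x y G i n then match n (deleteEdge x y G ∖ (i , n)) (suc t) else 0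
  hidden : (deleteEdge x y G ∖ (i , n)) ≈[ n ] (G ∖ (i , n))
  hidden a b _ _ = deleteEdge-hidden x y G (i , n) a b (disjointᵇ-shared i n x y ([ inj₁ , inj₂ ∘ inj₁ ]′ i∈xy))
  absent : (if (G ∖ (x , y)) i n then match n ((G ∖ (x , y)) ∖ (i , n)) t else 0) ≡ 0
  absent = cong (λ b → if b then match n ((G ∖ (x , y)) ∖ (i , n)) t else 0)
                (∖-meets G (x , y) i n (disjointᵇ-shared x y i n ([ inj₁ ∘ sym , inj₂ ∘ inj₂ ∘ inj₁ ∘ sym ]′ i∈xy)))

-- In general, induct on the number of vertices; each neighbour i of the last vertex n
-- either is an endpoint of {x , y}, or sees the edge {x , y} survive in G ∖ (i , n).
match-deleteEdge : ∀ n G x y t → x < y → y < n → T (G x y) →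
  match n G (suc t) ≡ match n (deleteEdge x y G) (suc t) + match n (G ∖ (x , y)) t
match-deleteEdge (suc n) G x y t x<y y<1+n xy∈G with y ≟ n
... | yes refl = match-deleteEdge-last n G x t x<y xy∈G
... | no y≢n = below t
  where
  y<n : y < n
  y<n = ≤∧≢⇒< (≤-pred y<1+n) y≢n
  x<n : x < n
  x<n = <-trans x<y y<n
  G' R : Graph
  G' = deleteEdge x y G
  R  = G ∖ (x , y)
  last-kept : ∀ i → G' i n ≡ G i n
  last-kept i = deleteEdge-keeps G (inj₂ (y≢n ∘ sym))
  IH : ∀ t → match n G (suc t) ≡ match n G' (suc t) + match n R t
  IH t = match-deleteEdge n G x y t x<y y<n xy∈G
  below : ∀ t → match (suc n) G (suc t) ≡ match (suc n) G' (suc t) + match (suc n) R t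
  below zero = begin
    match n G 1 + sumTo n (λ i → if G i n then 1 else 0)
      ≡⟨ cong₂ _+_ (IH zero) (sumTo-cong n (λ i _ → cong (if_then 1 else 0) (sym (last-kept i)))) ⟩
    (match n G' 1 + 1) + sumTo n (λ i → if G' i n then 1 else 0)
      ≡⟨ +-rightComm (match n G' 1) 1 _ ⟩
    match (suc n) G' 1 + 1 ∎
    where open ≡-Reasoning
  below (suc t) = begin
    match n G (suc (suc t)) + sumTo n f
      ≡⟨ cong₂ _+_ (IH (suc t)) (trans (sumTo-cong n split) (sumTo-+ n f' r)) ⟩
    (match n G' (suc (suc t)) + match n R (suc t)) + (sumTo n f' + sumTo n r)
      ≡⟨ interchange (match n G' (suc (suc t))) (match n R (suc t)) (sumTo n f') (sumTo n r) ⟩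
    match (suc n) G' (suc (suc t)) + match (suc n) R (suc t) ∎
    where
    open ≡-Reasoning
    f f' r : ℕ → ℕ
    f  i = if G  i n then match n (G  ∖ (i , n)) (suc t) else 0
    f' i = if G' i n then match n (G' ∖ (i , n)) (suc t) else 0
    r  i = if R  i n then match n (R  ∖ (i , n)) t else 0
    -- otherwise the edge {x , y} survives in G ∖ (i , n), and the induction hypothesis applies
    elsewhere : ∀ i → i < n → i ≢ x → i ≢ y → f i ≡ f' i + r i
    elsewhere i i<n i≢x i≢y rewrite last-kept i | ∖-apart G (x , y) i n (disjointᵇ-apart (i≢x ∘ sym) (<⇒≢ x<n) (i≢y ∘ sym) (<⇒≢ y<n)) with G i n
    ... | false = refl
    ... | true = begin
      match n (G ∖ (i , n)) (suc t)
        ≡⟨ match-deleteEdge n (G ∖ (i , n)) x y t x<y y<n xy∈G∖ ⟩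
      match n (deleteEdge x y (G ∖ (i , n))) (suc t) + match n ((G ∖ (i , n)) ∖ (x , y)) t
        ≡⟨ cong₂ _+_ (match-cong n (suc t) (λ a b _ _ → deleteEdge-∖ x y G (i , n) a b)) (match-cong n t (λ a b _ _ → ∖-comm G (i , n) (x , y) a b)) ⟩
      match n (G' ∖ (i , n)) (suc t) + match n (R ∖ (i , n)) t ∎
      where
      xy∈G∖ : T ((G ∖ (i , n)) x y)
      xy∈G∖ = subst T (sym (∖-apart G (i , n) x y (disjointᵇ-apart i≢x i≢y (<⇒≢ x<n ∘ sym) (<⇒≢ y<n ∘ sym)))) xy∈G
    split : ∀ i → i < n → f i ≡ f' i + r i
    split i i<n with i ≟ x | i ≟ y
    ... | yes i≡x | _       = deleteEdge-endpointTerm n G x y t i y≢n (inj₁ i≡x)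
    ... | no _    | yes i≡y = deleteEdge-endpointTerm n G x y t i y≢n (inj₂ i≡y)
    ... | no i≢x  | no i≢y  = elsewhere i i<n i≢x i≢y

-- mK N t = m(K_N , t): the last vertex is unmatched, or matched to one of the other N.
mK : ℕ → ℕ → ℕ
mK N       zero    = 1
mK zero    (suc t) = 0
mK (suc N) (suc t) = mK N (suc t) + N * mK (N ∸ 1) t

-- mKK a b t = m(K_a ∪ K_b , t), by the same recursion on the second clique.
mKK : ℕ → ℕ → ℕ → ℕ
mKK a b       zero    = 1
mKK a zero    (suc t) = mK a (suc t)
mKK a (suc b) (suc t) = mKK a b (suc t) + b * mKK a (b ∸ 1) t

mKK-zero : ∀ a t → mKK a 0 t ≡ mK a t
mKK-zero a zero    = refl
mKK-zero a (suc t) = refl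

mKK-sucˡ : ∀ a b t → mKK (suc a) b (suc t) ≡ mKK a b (suc t) + a * mKK (a ∸ 1) b t
mKK-sucˡ a zero t = cong (λ z → mK a (suc t) + a * z) (sym (mKK-zero (a ∸ 1) t))
mKK-sucˡ a (suc zero) zero = begin
  mKK (suc a) 0 1 + 0            ≡⟨ cong (_+ 0) (mKK-sucˡ a zero zero) ⟩
  mKK a 0 1 + a * 1 + 0          ≡⟨ solve 2 (λ x y → x :+ y :* con 1 :+ con 0 := x :+ con 0 :* con 1 :+ y :* con 1) refl (mKK a 0 1) a ⟩
  mKK a 0 1 + 0 * 1 + a * 1      ∎
  where open ≡-Reasoning
mKK-sucˡ a (suc zero) (suc t) = begin
  mKK (suc a) 0 (suc (suc t)) + 0
    ≡⟨ cong (_+ 0) (mKK-sucˡ a zero (suc t)) ⟩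
  mKK a 0 (suc (suc t)) + a * mKK (a ∸ 1) 0 (suc t) + 0
    ≡⟨ solve 3 (λ x a' y → x :+ a' :* y :+ con 0 := x :+ con 0 :+ a' :* (y :+ con 0)) refl (mKK a 0 (suc (suc t))) a (mKK (a ∸ 1) 0 (suc t)) ⟩
  mKK a 0 (suc (suc t)) + 0 * mKK a 0 (suc t) + a * (mKK (a ∸ 1) 0 (suc t) + 0 * mKK (a ∸ 1) 0 t) ∎
  where open ≡-Reasoning
mKK-sucˡ a (suc (suc b)) zero = begin
  mKK (suc a) (suc b) 1 + suc b * 1
    ≡⟨ cong (_+ suc b * 1) (mKK-sucˡ a (suc b) zero) ⟩
  mKK a (suc b) 1 + a * 1 + suc b * 1
    ≡⟨ +-rightComm (mKK a (suc b) 1) (a * 1) (suc b * 1) ⟩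
  mKK a (suc b) 1 + suc b * 1 + a * 1 ∎
  where open ≡-Reasoning
mKK-sucˡ a (suc (suc b)) (suc t) = begin
  mKK (suc a) (suc b) (suc (suc t)) + suc b * mKK (suc a) b (suc t)
    ≡⟨ cong₂ _+_ (mKK-sucˡ a (suc b) (suc t)) (cong (suc b *_) (mKK-sucˡ a b t)) ⟩
  (mKK a (suc b) (suc (suc t)) + a * mKK (a ∸ 1) (suc b) (suc t)) + suc b * (mKK a b (suc t) + a * mKK (a ∸ 1) b t)
    ≡⟨ solve 6 (λ x a' y b' z w → (x :+ a' :* y) :+ b' :* (z :+ a' :* w) := (x :+ b' :* z) :+ a' :* (y :+ b' :* w)) refl
               (mKK a (suc b) (suc (suc t))) a (mKK (a ∸ 1) (suc b) (suc t)) (suc b) (mKK a b (suc t)) (mKK (a ∸ 1) b t) ⟩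
  mKK a (suc (suc b)) (suc (suc t)) + a * mKK (a ∸ 1) (suc (suc b)) (suc t) ∎
  where open ≡-Reasoning

-- Matchings of K_α ∪ K_β together with those using one extra edge between the two cliques
-- (α β choices, the rest a matching of K_{α-1} ∪ K_{β-1}) are matchings of K_{α+β}.
mutual
  mKK-cross : ∀ α β t → mKK α β (suc t) + α * β * mKK (α ∸ 1) (β ∸ 1) t ≤ mK (α + β) (suc t)
  mKK-cross α zero t rewrite *-zeroʳ α | +-identityʳ α = ≤-reflexive (+-identityʳ _)
  mKK-cross α (suc β) t rewrite +-suc α β = +-cancelˡ-≤ (α * β * W) _ _ combined
    where
    X Y Z W C₁ C₂ : ℕ
    X = mKK α β (suc t)
    Y = mKK α (β ∸ 1) t
    Z = mKK (α ∸ 1) β t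
    W = mKK (α ∸ 1) (β ∸ 1) t
    C₁ = mK (α + β) (suc t)
    C₂ = mK (α + β ∸ 1) t
    -- the new vertex of K_{β+1} matched across to K_α: the rest lies in K_{α+β-1}
    inK : ∀ a → a * mKK (a ∸ 1) β t ≤ a * mK (a + β ∸ 1) t
    inK zero     = z≤n
    inK (suc a') = *-monoʳ-≤ (suc a') (mKK≤mK a' β t)
    combined : α * β * W + ((X + β * Y) + α * suc β * Z) ≤ α * β * W + (C₁ + (α + β) * C₂)
    combined = subst₂ _≤_
      (solve 6 (λ a b x y z w → (x :+ a :* b :* w) :+ (a :* z :+ (b :* y :+ a :* b :* z)) := a :* b :* w :+ ((x :+ b :* y) :+ a :* (con 1 :+ b) :* z)) refl α β X Y Z W)
      (solve 5 (λ a b c₁ c₂ w → c₁ :+ (a :* c₂ :+ (b :* c₂ :+ a :* b :* w)) := a :* b :* w :+ (c₁ :+ (a :+ b) :* c₂)) refl α β C₁ C₂ W)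
      (+-mono-≤ (mKK-cross α β t) (+-mono-≤ (inK α) (cross-step α β t)))

  -- In the step β → β+1 of mKK-cross: the matchings pairing the new vertex inside its
  -- clique (β Y) and the cross edges at the old vertices (α β Z) are controlled by
  -- mKK-cross one size down; it is β+1 times cross-step₁.
  cross-step : ∀ α β t → β * mKK α (β ∸ 1) t + α * β * mKK (α ∸ 1) β t ≤ β * mK (α + β ∸ 1) t + α * β * mKK (α ∸ 1) (β ∸ 1) t
  cross-step α zero t rewrite *-zeroʳ α = z≤n
  cross-step α (suc β) t rewrite +-suc α β = subst₂ _≤_
    (solve 4 (λ a b y z → (con 1 :+ b) :* (y :+ a :* z) := (con 1 :+ b) :* y :+ a :* (con 1 :+ b) :* z) refl α β (mKK α β t) (mKK (α ∸ 1) (suc β) t))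
    (solve 4 (λ a b y z → (con 1 :+ b) :* (y :+ a :* z) := (con 1 :+ b) :* y :+ a :* (con 1 :+ b) :* z) refl α β (mK (α + β) t) (mKK (α ∸ 1) β t))
    (*-monoʳ-≤ (suc β) (cross-step₁ α β t))

  -- mKK-cross at t-1, unfolded by the recursion of mKK in its second argument.
  cross-step₁ : ∀ α β t → mKK α β t + α * mKK (α ∸ 1) (suc β) t ≤ mK (α + β) t + α * mKK (α ∸ 1) β t
  cross-step₁ α β zero = ≤-refl
  cross-step₁ α β (suc t) = subst₂ _≤_
    (solve 5 (λ a b x y w → (x :+ a :* b :* w) :+ a :* y := x :+ a :* (y :+ b :* w)) refl α β (mKK α β (suc t)) (mKK (α ∸ 1) β (suc t)) (mKK (α ∸ 1) (β ∸ 1) t))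
    refl
    (+-mono-≤ (mKK-cross α β t) (≤-refl {α * mKK (α ∸ 1) β (suc t)}))

  mKK≤mK : ∀ α β t → mKK α β t ≤ mK (α + β) t
  mKK≤mK α β zero    = ≤-refl
  mKK≤mK α β (suc t) = ≤-trans (m≤m+n (mKK α β (suc t)) _) (mKK-cross α β t)

-- K_p ∪ K_m joined by one edge has at most as many (t+1)-matchings as K_{p+m-1} with a
-- pendant vertex of degree 1: both count (unused extra edge) + (used extra edge).
oneBridge≤pendant : ∀ p m t → 1 ≤ p → 1 ≤ m →
  mKK p m (suc t) + mKK (p ∸ 1) (m ∸ 1) t ≤ mK (p + m ∸ 1) (suc t) + mK (p + m ∸ 2) t
oneBridge≤pendant (suc a) (suc b) t _ _ rewrite +-suc a b = bound t
  where
  bound : ∀ t → mKK (suc a) (suc b) (suc t) + mKK a b t ≤ mK (suc a + b) (suc t) + mK (a + b) t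
  bound zero =
    ≤-trans (m≤m+n (mKK (suc a) b 1 + b * 1 + 1) (a * b * 1))
            (≤-trans (≤-reflexive rearrange) (+-mono-≤ (mKK-cross (suc a) b zero) (≤-refl {1})))
    where
    rearrange : mKK (suc a) b 1 + b * 1 + 1 + a * b * 1 ≡ mKK (suc a) b 1 + suc a * b * 1 + 1
    rearrange = solve 3 (λ x a b → x :+ b :* con 1 :+ con 1 :+ a :* b :* con 1 := x :+ (con 1 :+ a) :* b :* con 1 :+ con 1) refl (mKK (suc a) b 1) a b
  bound (suc t) =
    ≤-trans (m≤m+n LHS (a * b * Y))
            (≤-trans (≤-reflexive rearrange) (+-mono-≤ (mKK-cross (suc a) b (suc t)) (mKK-cross a b t)))
    where
    X Y W V LHS : ℕ
    X = mKK (suc a) b (suc (suc t))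
    Y = mKK a (b ∸ 1) (suc t)
    W = mKK (a ∸ 1) (b ∸ 1) t
    V = mKK a b (suc t)
    LHS = X + b * mKK (suc a) (b ∸ 1) (suc t) + V
    rearrange : LHS + a * b * Y ≡ (X + suc a * b * Y) + (V + a * b * W)
    rearrange = trans (cong (λ z → X + b * z + V + a * b * Y) (mKK-sucˡ a (b ∸ 1) t))
      (solve 6 (λ a b x y w v → x :+ b :* (y :+ a :* w) :+ v :+ a :* b :* y := (x :+ (con 1 :+ a) :* b :* y) :+ (v :+ a :* b :* w)) refl a b X Y W V)

-- Distinct vertices are adjacent iff they carry the same nonzero colour; colour 0 marks
-- a deleted vertex.
cliques : (ℕ → ℕ) → Graph
cliques col a b = (col a ≡ᵇ col b) ∧ (not (col a ≡ᵇ 0) ∧ not (a ≡ᵇ b))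

uncolour : ℕ → (ℕ → ℕ) → (ℕ → ℕ)
uncolour i col j = if i ≡ᵇ j then 0 else col j

colourCount : ℕ → ℕ → (ℕ → ℕ) → ℕ
colourCount n c col = sumTo n (λ j → if col j ≡ᵇ c then 1 else 0)

cliques-∖ : ∀ col x y a b → (cliques col ∖ (x , y)) a b ≡ cliques (uncolour x (uncolour y col)) a b
cliques-∖ col x y a b with x ≡ᵇ a | x ≡ᵇ b | y ≡ᵇ a | y ≡ᵇ b
... | true  | _     | _     | _     = trans (∧-zeroʳ _) (sym (∧-zeroʳ _))
... | false | true  | y≡a   | _     = trans (∧-zeroʳ _) (sym (∧-not-self ((if y≡a then 0 else col a) ≡ᵇ 0) (not (a ≡ᵇ b))))
... | false | false | true  | _     = trans (∧-zeroʳ _) (sym (∧-zeroʳ _))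
... | false | false | false | true  = trans (∧-zeroʳ _) (sym (∧-not-self (col a ≡ᵇ 0) (not (a ≡ᵇ b))))
... | false | false | false | false = ∧-identityʳ _

cliques-agree : ∀ {n} col col' → (∀ j → j < n → col j ≡ col' j) → cliques col ≈[ n ] cliques col'
cliques-agree col col' same a b a<b b<n rewrite same a (<-trans a<b b<n) | same b b<n = refl

cliques-∖-last : ∀ col i n → (cliques col ∖ (i , n)) ≈[ n ] cliques (uncolour i col)
cliques-∖-last col i n a b a<b b<n =
  trans (cliques-∖ col i n a b) (cliques-agree (uncolour i (uncolour n col)) (uncolour i col) below a b a<b b<n)
  where
  below : ∀ j → j < n → uncolour i (uncolour n col) j ≡ uncolour i col j
  below j j<n rewrite ≡ᵇ-false (<⇒≢ j<n ∘ sym) = refl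

cliques-last : ∀ col i n → i < n → cliques col i n ≡ (col i ≡ᵇ col n) ∧ not (col i ≡ᵇ 0)
cliques-last col i n i<n rewrite ≡ᵇ-false (<⇒≢ i<n) = cong ((col i ≡ᵇ col n) ∧_) (∧-identityʳ _)

colourCount-uncolour : ∀ n c col i → i < n → col i ≡ c → c ≢ 0 →
  colourCount n c col ≡ suc (colourCount n c (uncolour i col))
colourCount-uncolour n c col i i<n coli≡c c≢0 =
  trans (sumTo-split n i i<n elsewhere at-i) (trans (cong (colourCount n c (uncolour i col) +_) counted) (+-comm _ 1))
  where
  elsewhere : ∀ j → j < n → j ≢ i → (if col j ≡ᵇ c then 1 else 0) ≡ (if uncolour i col j ≡ᵇ c then 1 else 0)
  elsewhere j _ j≢i rewrite ≡ᵇ-false (j≢i ∘ sym) = refl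
  at-i : (if uncolour i col i ≡ᵇ c then 1 else 0) ≡ 0
  at-i rewrite ≡ᵇ-refl i | ≡ᵇ-false (c≢0 ∘ sym) = refl
  counted : (if col i ≡ᵇ c then 1 else 0) ≡ 1
  counted rewrite coli≡c | ≡ᵇ-refl c = refl

colourCount-uncolour-other : ∀ n d col i → col i ≢ d → d ≢ 0 → colourCount n d (uncolour i col) ≡ colourCount n d col
colourCount-uncolour-other n d col i coli≢d d≢0 = sumTo-cong n same
  where
  same : ∀ j → j < n → (if uncolour i col j ≡ᵇ d then 1 else 0) ≡ (if col j ≡ᵇ d then 1 else 0)
  same j _ with i ≟ j
  ... | yes refl rewrite ≡ᵇ-refl i | ≡ᵇ-false (d≢0 ∘ sym) | ≡ᵇ-false coli≢d = refl
  ... | no i≢j rewrite ≡ᵇ-false i≢j = refl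

neighbourSum : ∀ n col c t K → col n ≡ c → c ≢ 0 →
  (∀ i → i < n → col i ≡ c → match n (cliques col ∖ (i , n)) t ≡ K) →
  sumTo n (λ i → if cliques col i n then match n (cliques col ∖ (i , n)) t else 0) ≡ colourCount n c col * K
neighbourSum n col c t K coln≡c c≢0 deleted = trans (sumTo-cong n term) (sumTo-indicator n (λ i → col i ≡ᵇ c) K)
  where
  term : ∀ i → i < n → (if cliques col i n then match n (cliques col ∖ (i , n)) t else 0) ≡ (if col i ≡ᵇ c then K else 0)
  term i i<n rewrite cliques-last col i n i<n | coln≡c with col i ≟ c
  ... | yes coli≡c rewrite coli≡c | ≡ᵇ-refl c | ≡ᵇ-false c≢0 = deleted i i<n coli≡c
  ... | no coli≢c rewrite ≡ᵇ-false coli≢c = refl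

uncolour-<3 : ∀ i col → (∀ j → col j < 3) → ∀ j → uncolour i col j < 3
uncolour-<3 i col col<3 j with i ≡ᵇ j
... | true  = s≤s z≤n
... | false = col<3 j

colourCount-suc : ∀ n col {v} c → col n ≡ v → colourCount (suc n) c col ≡ colourCount n c col + (if v ≡ᵇ c then 1 else 0)
colourCount-suc n col c coln≡v = cong (λ w → colourCount n c col + (if w ≡ᵇ c then 1 else 0)) coln≡v

match-cliques : ∀ n col t → (∀ j → col j < 3) → match n (cliques col) t ≡ mKK (colourCount n 1 col) (colourCount n 2 col) t
match-cliques n       col zero    _     = refl
match-cliques zero    col (suc t) _     = refl
match-cliques (suc n) col (suc t) col<3 = byLastColour (col n) refl (col<3 n)
  where
  A B M : ℕ
  A = colourCount n 1 col
  B = colourCount n 2 col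
  M = match n (cliques col) (suc t)
  neighbours : ℕ
  neighbours = sumTo n (λ i → if cliques col i n then match n (cliques col ∖ (i , n)) t else 0)
  deleted : ∀ i → i < n → match n (cliques col ∖ (i , n)) t
                        ≡ mKK (colourCount n 1 (uncolour i col)) (colourCount n 2 (uncolour i col)) t
  deleted i _ = trans (match-cong n t (cliques-∖-last col i n)) (match-cliques n (uncolour i col) t (uncolour-<3 i col col<3))
  deleted₁ : ∀ i → i < n → col i ≡ 1 → match n (cliques col ∖ (i , n)) t ≡ mKK (A ∸ 1) B t
  deleted₁ i i<n coli≡1 = trans (deleted i i<n) (cong₂ (λ a b → mKK a b t)
    (cong (_∸ 1) (sym (colourCount-uncolour n 1 col i i<n coli≡1 λ ())))
    (colourCount-uncolour-other n 2 col i (λ coli≡2 → case trans (sym coli≡1) coli≡2 of λ ()) λ ()))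
  deleted₂ : ∀ i → i < n → col i ≡ 2 → match n (cliques col ∖ (i , n)) t ≡ mKK A (B ∸ 1) t
  deleted₂ i i<n coli≡2 = trans (deleted i i<n) (cong₂ (λ a b → mKK a b t)
    (colourCount-uncolour-other n 1 col i (λ coli≡1 → case trans (sym coli≡2) coli≡1 of λ ()) λ ())
    (cong (_∸ 1) (sym (colourCount-uncolour n 2 col i i<n coli≡2 λ ()))))
  byLastColour : ∀ v → col n ≡ v → v < 3 → M + neighbours ≡ mKK (colourCount (suc n) 1 col) (colourCount (suc n) 2 col) (suc t)
  byLastColour 0 coln≡0 _ = begin
    M + neighbours         ≡⟨ cong₂ _+_ (match-cliques n col (suc t) col<3) (sumTo-zero n isolated) ⟩
    mKK A B (suc t) + 0    ≡⟨ +-identityʳ _ ⟩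
    mKK A B (suc t)        ≡⟨ cong₂ (λ a b → mKK a b (suc t)) (trans (colourCount-suc n col 1 coln≡0) (+-identityʳ A))
                                                               (trans (colourCount-suc n col 2 coln≡0) (+-identityʳ B)) ⟨
    mKK (colourCount (suc n) 1 col) (colourCount (suc n) 2 col) (suc t) ∎
    where
    open ≡-Reasoning
    isolated : ∀ i → i < n → (if cliques col i n then match n (cliques col ∖ (i , n)) t else 0) ≡ 0
    isolated i i<n rewrite cliques-last col i n i<n | coln≡0 | ∧-inverseʳ (col i ≡ᵇ 0) = refl
  byLastColour 1 coln≡1 _ = begin
    M + neighbours                            ≡⟨ cong₂ _+_ (match-cliques n col (suc t) col<3) (neighbourSum n col 1 t _ coln≡1 (λ ()) deleted₁) ⟩
    mKK A B (suc t) + A * mKK (A ∸ 1) B t     ≡⟨ mKK-sucˡ A B t ⟨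
    mKK (suc A) B (suc t)                     ≡⟨ cong₂ (λ a b → mKK a b (suc t)) (trans (colourCount-suc n col 1 coln≡1) (+-comm A 1))
                                                                                  (trans (colourCount-suc n col 2 coln≡1) (+-identityʳ B)) ⟨
    mKK (colourCount (suc n) 1 col) (colourCount (suc n) 2 col) (suc t) ∎
    where open ≡-Reasoning
  byLastColour 2 coln≡2 _ = begin
    M + neighbours                            ≡⟨ cong₂ _+_ (match-cliques n col (suc t) col<3) (neighbourSum n col 2 t _ coln≡2 (λ ()) deleted₂) ⟩
    mKK A B (suc t) + B * mKK A (B ∸ 1) t     ≡⟨⟩
    mKK A (suc B) (suc t)                     ≡⟨ cong₂ (λ a b → mKK a b (suc t)) (trans (colourCount-suc n col 1 coln≡2) (+-identityʳ A))
                                                                                  (trans (colourCount-suc n col 2 coln≡2) (+-comm B 1)) ⟨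
    mKK (colourCount (suc n) 1 col) (colourCount (suc n) 2 col) (suc t) ∎
    where open ≡-Reasoning
  byLastColour (suc (suc (suc _))) _ (s≤s (s≤s (s≤s ())))

match-cliques₁ : ∀ n col t → (∀ j → col j ≤ 1) → match n (cliques col) t ≡ mK (colourCount n 1 col) t
match-cliques₁ n col t col≤1 = begin
  match n (cliques col) t                                   ≡⟨ match-cliques n col t (λ j → s≤s (≤-trans (col≤1 j) (s≤s z≤n))) ⟩
  mKK (colourCount n 1 col) (colourCount n 2 col) t         ≡⟨ cong (λ b → mKK (colourCount n 1 col) b t) (sumTo-zero n no-2) ⟩
  mKK (colourCount n 1 col) 0 t                             ≡⟨ mKK-zero (colourCount n 1 col) t ⟩
  mK (colourCount n 1 col) t                                ∎
  where
  open ≡-Reasoning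
  no-2 : ∀ j → j < n → (if col j ≡ᵇ 2 then 1 else 0) ≡ 0
  no-2 j _ rewrite ≡ᵇ-false {col j} {2} (λ colj≡2 → <⇒≱ (s≤s (s≤s z≤n)) (subst (_≤ 1) colj≡2 (col≤1 j))) = refl

uncolour-≤1 : ∀ i col → (∀ j → col j ≤ 1) → ∀ j → uncolour i col j ≤ 1
uncolour-≤1 i col col≤1 j with i ≡ᵇ j
... | true  = z≤n
... | false = col≤1 j

all-1 : ℕ → ℕ
all-1 _ = 1

complete : Graph
complete = cliques all-1

⊆-complete : ∀ {n} G → G ⊆[ n ] complete
⊆-complete G a b a<b _ _ rewrite ≡ᵇ-false (<⇒≢ a<b) = _

match-complete-∖-last : ∀ n i t → i < n → match n (complete ∖ (i , n)) t ≡ mK (n ∸ 1) t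
match-complete-∖-last n i t i<n = begin
  match n (complete ∖ (i , n)) t              ≡⟨ match-cong n t (cliques-∖-last all-1 i n) ⟩
  match n (cliques (uncolour i all-1)) t      ≡⟨ match-cliques₁ n (uncolour i all-1) t (uncolour-≤1 i all-1 λ _ → ≤-refl) ⟩
  mK (colourCount n 1 (uncolour i all-1)) t   ≡⟨ cong (λ c → mK (c ∸ 1) t) (trans (sym (sumTo-ones n)) (colourCount-uncolour n 1 all-1 i i<n refl λ ())) ⟨
  mK (n ∸ 1) t                                ∎
  where open ≡-Reasoning

match-complete-∖ : ∀ n x y t → x < n → y < n → x ≢ y → match n (complete ∖ (x , y)) t ≡ mK (n ∸ 2) t
match-complete-∖ n x y t x<n y<n x≢y = begin
  match n (complete ∖ (x , y)) t        ≡⟨ match-cong n t (λ a b _ _ → cliques-∖ all-1 x y a b) ⟩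
  match n (cliques col) t               ≡⟨ match-cliques₁ n col t (uncolour-≤1 x _ (uncolour-≤1 y all-1 λ _ → ≤-refl)) ⟩
  mK (colourCount n 1 col) t            ≡⟨ cong (λ c → mK (c ∸ 2) t) count ⟨
  mK (n ∸ 2) t                          ∎
  where
  open ≡-Reasoning
  col : ℕ → ℕ
  col = uncolour x (uncolour y all-1)
  count : n ≡ suc (suc (colourCount n 1 col))
  count = trans (sym (sumTo-ones n)) (trans (colourCount-uncolour n 1 all-1 y y<n refl λ ())
                (cong suc (colourCount-uncolour n 1 (uncolour y all-1) x x<n (cong (if_then 0 else 1) (≡ᵇ-false (x≢y ∘ sym))) λ ())))

match-∖-bound : ∀ n G x y t → x < n → y < n → x ≢ y → match n (G ∖ (x , y)) t ≤ mK (n ∸ 2) t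
match-∖-bound n G x y t x<n y<n x≢y =
  ≤-trans (match-mono n t (∖-mono (x , y) (⊆-complete G))) (≤-reflexive (match-complete-∖ n x y t x<n y<n x≢y))

match-complete : ∀ n t → match n complete t ≡ mK n t
match-complete n t = trans (match-cliques₁ n all-1 t (λ _ → ≤-refl)) (cong (λ c → mK c t) (sumTo-ones n))

data Position (p a b : ℕ) : Set where
  inLeft  : b < p → Position p a b
  across  : a < p → p ≤ b → Position p a b
  inRight : p ≤ a → Position p a b

position : ∀ p a b → Position p a b
position p a b with b <? p | a <? p
... | yes b<p | _       = inLeft b<p
... | no b≮p  | yes a<p = across a<p (≮⇒≥ b≮p)
... | no _    | no a≮p  = inRight (≮⇒≥ a≮p)

Kbridge-left : ∀ n m k a b → a < b → b < n ∸ m → Kbridge n m k a b ≡ not (a ≡ᵇ b)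
Kbridge-left n m k a b a<b b<p rewrite <ᵇ-true (<-trans a<b b<p) | <ᵇ-true b<p = refl

Kbridge-right : ∀ n m k a b → a < b → n ∸ m ≤ a → Kbridge n m k a b ≡ not (a ≡ᵇ b)
Kbridge-right n m k a b a<b p≤a rewrite <ᵇ-false p≤a | <ᵇ-false (≤-trans p≤a (<⇒≤ a<b)) = refl

Kbridge-across : ∀ n m k a b → a < n ∸ m → n ∸ m ≤ b → Kbridge n m k a b ≡ (a <ᵇ k) ∧ (b ≡ᵇ n ∸ m + a)
Kbridge-across n m k a b a<p p≤b rewrite <ᵇ-true a<p | <ᵇ-false p≤b = refl

sides : ℕ → ℕ → ℕ
sides p i = if i <ᵇ p then 1 else 2

sides-<3 : ∀ p i → sides p i < 3
sides-<3 p i with i <ᵇ p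
... | true  = s≤s (s≤s z≤n)
... | false = s≤s (s≤s (s≤s z≤n))

Kbridge-none : ∀ n m → Kbridge n m 0 ≈[ n ] cliques (sides (n ∸ m))
Kbridge-none n m a b a<b _ with position (n ∸ m) a b
... | inLeft b<p rewrite Kbridge-left n m 0 a b a<b b<p | <ᵇ-true b<p | <ᵇ-true (<-trans a<b b<p) = refl
... | across a<p p≤b rewrite Kbridge-across n m 0 a b a<p p≤b | <ᵇ-true a<p | <ᵇ-false p≤b = refl
... | inRight p≤a rewrite Kbridge-right n m 0 a b a<b p≤a | <ᵇ-false p≤a | <ᵇ-false (≤-trans p≤a (<⇒≤ a<b)) = refl

Kbridge-removeLast : ∀ n m j → j < n ∸ m → deleteEdge j (n ∸ m + j) (Kbridge n m (suc j)) ≈[ n ] Kbridge n m j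
Kbridge-removeLast n m j j<p a b a<b _ with position (n ∸ m) a b
... | inLeft b<p = trans (deleteEdge-keeps (Kbridge n m (suc j)) (inj₂ λ b≡p+j → <⇒≱ b<p (subst (n ∸ m ≤_) (sym b≡p+j) (m≤m+n (n ∸ m) j))))
                         (trans (Kbridge-left n m (suc j) a b a<b b<p) (sym (Kbridge-left n m j a b a<b b<p)))
... | inRight p≤a = trans (deleteEdge-keeps (Kbridge n m (suc j)) (inj₁ λ a≡j → <⇒≱ j<p (subst (n ∸ m ≤_) a≡j p≤a)))
                          (trans (Kbridge-right n m (suc j) a b a<b p≤a) (sym (Kbridge-right n m j a b a<b p≤a)))
... | across a<p p≤b rewrite Kbridge-across n m (suc j) a b a<p p≤b | Kbridge-across n m j a b a<p p≤b with a ≟ j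
...   | yes refl rewrite <ᵇ-true (n<1+n a) | <ᵇ-false (≤-refl {a}) | ≡ᵇ-refl a = ∧-inverseʳ (b ≡ᵇ n ∸ m + a)
...   | no a≢j rewrite ≡ᵇ-false a≢j | <ᵇ-suc a≢j = ∧-identityʳ _

Kbridge-bridge : ∀ n m k j → j < k → j < n ∸ m → T (Kbridge n m k j (n ∸ m + j))
Kbridge-bridge n m k j j<k j<p rewrite Kbridge-across n m k j (n ∸ m + j) j<p (m≤m+n (n ∸ m) j) | <ᵇ-true j<k | ≡ᵇ-refl (n ∸ m + j) = _

-- Counting matchings of K^k_{n-m,m} (1 ≤ m ≤ n - m, p = n - m) by contracting its bridges
-- one at a time.
module Bridges (n m : ℕ) (1≤m : 1 ≤ m) (m≤p : m ≤ n ∸ m) where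

  p : ℕ
  p = n ∸ m

  1≤p : 1 ≤ p
  1≤p = ≤-trans 1≤m m≤p

  m≤n : m ≤ n
  m≤n = ≤-trans m≤p (m∸n≤m n m)

  p+m≡n : p + m ≡ n
  p+m≡n = m∸n+n≡m m≤n

  j<p : ∀ {j} → j < m → j < p
  j<p j<m = <-≤-trans j<m m≤p

  p+j<n : ∀ {j} → j < m → p + j < n
  p+j<n j<m = subst (p + _ <_) p+m≡n (+-monoʳ-< p j<m)

  j<p+j : ∀ j → j < p + j
  j<p+j j = m<n+m j 1≤p

  sides-left : colourCount n 1 (sides p) ≡ p
  sides-left = trans (sumTo-cong n (λ i _ → one i)) (count-below-≤ n p (m∸n≤m n m))
    where
    one : ∀ i → (if sides p i ≡ᵇ 1 then 1 else 0) ≡ (if i <ᵇ p then 1 else 0)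
    one i with i <ᵇ p
    ... | true  = refl
    ... | false = refl

  sides-right : colourCount n 2 (sides p) ≡ m
  sides-right = trans (sumTo-cong n (λ i _ → two i)) (trans (count-above-≤ n p (m∸n≤m n m)) (m∸[m∸n]≡n m≤n))
    where
    two : ∀ i → (if sides p i ≡ᵇ 2 then 1 else 0) ≡ (if i <ᵇ p then 0 else 1)
    two i with i <ᵇ p
    ... | true  = refl
    ... | false = refl

  match-noBridge : ∀ t → match n (Kbridge n m 0) t ≡ mKK p m t
  match-noBridge t = begin
    match n (Kbridge n m 0) t                                        ≡⟨ match-cong n t (Kbridge-none n m) ⟩
    match n (cliques (sides p)) t                                    ≡⟨ match-cliques n (sides p) t (sides-<3 p) ⟩
    mKK (colourCount n 1 (sides p)) (colourCount n 2 (sides p)) t    ≡⟨ cong₂ (λ a b → mKK a b t) sides-left sides-right ⟩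
    mKK p m t                                                        ∎
    where open ≡-Reasoning

  -- Adding the bridge {j , p + j}: deletion–contraction on it.
  bridge-step : ∀ j t → j < m →
    match n (Kbridge n m (suc j)) (suc t) ≡ match n (Kbridge n m j) (suc t) + match n (Kbridge n m (suc j) ∖ (j , p + j)) t
  bridge-step j t j<m =
    trans (match-deleteEdge n _ j (p + j) t (j<p+j j) (p+j<n j<m) (Kbridge-bridge n m (suc j) j (n<1+n j) (j<p j<m)))
          (cong (_+ match n (Kbridge n m (suc j) ∖ (j , p + j)) t) (match-cong n (suc t) (Kbridge-removeLast n m j (j<p j<m))))

  firstBridge-contracted : ∀ t → match n (Kbridge n m 1 ∖ (0 , p + 0)) t ≡ mKK (p ∸ 1) (m ∸ 1) t
  firstBridge-contracted t = begin
    match n (Kbridge n m 1 ∖ e) t        ≡⟨ match-cong n t unbridged ⟩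
    match n (cliques col) t              ≡⟨ match-cliques n col t (uncolour-<3 0 col' (uncolour-<3 (p + 0) (sides p) (sides-<3 p))) ⟩
    mKK (colourCount n 1 col) (colourCount n 2 col) t
      ≡⟨ cong₂ (λ a b → mKK a b t) left right ⟩
    mKK (p ∸ 1) (m ∸ 1) t                ∎
    where
    open ≡-Reasoning
    e : Edge
    e = (0 , p + 0)
    col' col : ℕ → ℕ
    col' = uncolour (p + 0) (sides p)
    col  = uncolour 0 col'
    unbridged : (Kbridge n m 1 ∖ e) ≈[ n ] cliques col
    unbridged a b a<b b<n = begin
      (Kbridge n m 1 ∖ e) a b                        ≡⟨ deleteEdge-hidden 0 (p + 0) (Kbridge n m 1) e a b (disjointᵇ-shared 0 (p + 0) 0 (p + 0) (inj₁ refl)) ⟨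
      (deleteEdge 0 (p + 0) (Kbridge n m 1) ∖ e) a b ≡⟨ ∖-cong e (≈-trans (Kbridge-removeLast n m 0 1≤p) (Kbridge-none n m)) a b a<b b<n ⟩
      (cliques (sides p) ∖ e) a b                    ≡⟨ cliques-∖ (sides p) 0 (p + 0) a b ⟩
      cliques col a b                                ∎
    p<n : p + 0 < n
    p<n = p+j<n 1≤m
    p-right : sides p (p + 0) ≡ 2
    p-right rewrite <ᵇ-false (m≤m+n p 0) = refl
    0-left : col' 0 ≡ 1
    0-left rewrite ≡ᵇ-false (<⇒≢ (<-≤-trans 1≤p (m≤m+n p 0)) ∘ sym) | <ᵇ-true 1≤p = refl
    left : colourCount n 1 col ≡ p ∸ 1
    left = cong (_∸ 1) (trans (sym (colourCount-uncolour n 1 col' 0 (≤-<-trans z≤n p<n) 0-left λ ()))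
                              (trans (colourCount-uncolour-other n 1 (sides p) (p + 0) (λ eq → case trans (sym p-right) eq of λ ()) λ ()) sides-left))
    right : colourCount n 2 col ≡ m ∸ 1
    right = trans (colourCount-uncolour-other n 2 col' 0 (λ eq → case trans (sym 0-left) eq of λ ()) λ ())
                  (cong (_∸ 1) (trans (sym (colourCount-uncolour n 2 (sides p) (p + 0) p<n p-right λ ())) sides-right))

  match-firstBridge : ∀ t → match n (Kbridge n m 1) (suc t) ≡ mKK p m (suc t) + mKK (p ∸ 1) (m ∸ 1) t
  match-firstBridge t = trans (bridge-step 0 t 1≤m) (cong₂ _+_ (match-noBridge (suc t)) (firstBridge-contracted t))

  -- Each further bridge adds at most m(K_{n-2}, t) matchings, those using it.
  match-bridges : ∀ j t → suc j ≤ m →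
    match n (Kbridge n m (suc j)) (suc t) ≤ mKK p m (suc t) + mKK (p ∸ 1) (m ∸ 1) t + j * mK (n ∸ 2) t
  match-bridges zero    t _     = ≤-reflexive (trans (match-firstBridge t) (sym (+-identityʳ _)))
  match-bridges (suc j) t j+2≤m = begin
    match n (Kbridge n m (suc (suc j))) (suc t)
      ≡⟨ bridge-step (suc j) t j+2≤m ⟩
    match n (Kbridge n m (suc j)) (suc t) + match n (Kbridge n m (suc (suc j)) ∖ (suc j , p + suc j)) t
      ≤⟨ +-mono-≤ (match-bridges j t (<⇒≤ j+2≤m)) (match-∖-bound n _ (suc j) (p + suc j) t (<-trans (j<p+j (suc j)) (p+j<n j+2≤m)) (p+j<n j+2≤m) (<⇒≢ (j<p+j (suc j)))) ⟩
    Z + j * C + C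
      ≡⟨ +-assoc Z (j * C) C ⟩
    Z + (j * C + C)
      ≡⟨ cong (Z +_) (+-comm (j * C) C) ⟩
    Z + suc j * C ∎
    where
    open ≤-Reasoning
    Z C : ℕ
    Z = mKK p m (suc t) + mKK (p ∸ 1) (m ∸ 1) t
    C = mK (n ∸ 2) t

  match-Kbridge≤ : ∀ k t → 1 ≤ k → k ≤ m → match n (Kbridge n m k) (suc t) ≤ mK (n ∸ 1) (suc t) + k * mK (n ∸ 2) t
  match-Kbridge≤ (suc j) t _ k≤m = begin
    match n (Kbridge n m (suc j)) (suc t)
      ≤⟨ match-bridges j t k≤m ⟩
    mKK p m (suc t) + mKK (p ∸ 1) (m ∸ 1) t + j * C
      ≤⟨ +-monoˡ-≤ (j * C) (subst (λ N → mKK p m (suc t) + mKK (p ∸ 1) (m ∸ 1) t ≤ mK (N ∸ 1) (suc t) + mK (N ∸ 2) t) p+m≡n (oneBridge≤pendant p m t 1≤p 1≤m)) ⟩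
    mK (n ∸ 1) (suc t) + C + j * C
      ≡⟨ +-assoc (mK (n ∸ 1) (suc t)) C (j * C) ⟩
    mK (n ∸ 1) (suc t) + suc j * C ∎
    where
    open ≤-Reasoning
    C : ℕ
    C = mK (n ∸ 2) t

Kpendant-below : ∀ n k → Kpendant (suc n) k ≈[ n ] complete
Kpendant-below n k a b a<b b<n rewrite <ᵇ-true b<n | <ᵇ-true (<-trans a<b b<n) = refl

Kpendant-last : ∀ n k i → i < n → Kpendant (suc n) k i n ≡ (i <ᵇ k)
Kpendant-last n k i i<n rewrite <ᵇ-true i<n | <ᵇ-false (≤-refl {n}) = refl

-- A (t+1)-matching of K^k_{n-1,1} leaves the pendant vertex free, or matches it to one of
-- its k neighbours and the rest lies in K_{n-2}.
match-pendant : ∀ n k t → 1 ≤ n → k ≤ n ∸ 1 → match n (Kpendant n k) (suc t) ≡ mK (n ∸ 1) (suc t) + k * mK (n ∸ 2) t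
match-pendant (suc n) k t _ k≤n =
  cong₂ _+_ (trans (match-cong n (suc t) (Kpendant-below n k)) (match-complete n (suc t)))
            (trans (sumTo-cong n term) (trans (sumTo-indicator n (_<ᵇ k) (mK (n ∸ 1) t)) (cong (_* mK (n ∸ 1) t) (count-below-≤ n k k≤n))))
  where
  term : ∀ i → i < n → (if Kpendant (suc n) k i n then match n (Kpendant (suc n) k ∖ (i , n)) t else 0) ≡ (if i <ᵇ k then mK (n ∸ 1) t else 0)
  term i i<n = cong₂ (λ b r → if b then r else 0) (Kpendant-last n k i i<n)
                     (trans (match-cong n t (∖-cong (i , n) (Kpendant-below n k))) (match-complete-∖-last n i t i<n))

half : ∀ n m → m ≤ n / 2 → m ≤ n ∸ m
half n m m≤n/2 = m+n≤o⇒m≤o∸n m (begin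
  m + m        ≡⟨ cong (m +_) (+-identityʳ m) ⟨
  2 * m        ≡⟨ *-comm 2 m ⟩
  m * 2        ≤⟨ *-monoˡ-≤ 2 m≤n/2 ⟩
  n / 2 * 2    ≤⟨ m/n*n≤m n 2 ⟩
  n            ∎)
  where open ≤-Reasoning

lemma2p8 : (n k m t : ℕ) → 2 ≤ n → 1 ≤ k → k ≤ m → m ≤ n / 2 → t ≤ n / 2 →
    matchings n (Kbridge n m k) t ≤ matchings n (Kpendant n k) t
lemma2p8 n k m zero _ _ _ _ _ =
  ≤-reflexive (trans (matchings≡match n (Kbridge n m k) zero) (sym (matchings≡match n (Kpendant n k) zero)))
lemma2p8 n k m (suc t) 2≤n 1≤k k≤m m≤n/2 _ = begin
  matchings n (Kbridge n m k) (suc t)     ≡⟨ matchings≡match n (Kbridge n m k) (suc t) ⟩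
  match n (Kbridge n m k) (suc t)         ≤⟨ Bridges.match-Kbridge≤ n m 1≤m m≤n∸m k t 1≤k k≤m ⟩
  mK (n ∸ 1) (suc t) + k * mK (n ∸ 2) t   ≡⟨ match-pendant n k t (≤-trans (s≤s z≤n) 2≤n) k≤n∸1 ⟨
  match n (Kpendant n k) (suc t)          ≡⟨ matchings≡match n (Kpendant n k) (suc t) ⟨
  matchings n (Kpendant n k) (suc t)      ∎
  where
  open ≤-Reasoning
  1≤m : 1 ≤ m
  1≤m = ≤-trans 1≤k k≤m
  m≤n∸m : m ≤ n ∸ m
  m≤n∸m = half n m m≤n/2
  k≤n∸1 : k ≤ n ∸ 1
  k≤n∸1 = ≤-trans k≤m (≤-trans m≤n∸m (∸-monoʳ-≤ n 1≤m))
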